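{- Let $\mathcal{M}=\langle M,\mathcal{S}^{\mathcal{M}},\in^{\mathcal{M}}\rangle$ be a model of $\mathrm{BAC}$. Then $\langle M,\subseteq^{\mathcal{M}}\rangle$ is a model of $\mathrm{IABA}$, $\mathcal{S}^{\mathcal{M}}$ is a proper ideal of $\langle M,\subseteq^{\mathcal{M}}\rangle$ that contains all of the atoms of $\langle M,\subseteq^{\mathcal{M}}\rangle$, and $\mathcal{S}^{\mathcal{M}}$ has the same cardinality as the set of atoms of $\langle M,\subseteq^{\mathcal{M}}\rangle$.
   Context: $\mathcal{L}_{cl}$ is the first-order language with a binary relation $\in$ and a unary predicate $\mathcal{S}$; a structure is $\langle M,\mathcal{S}^{\mathcal{M}},\in^{\mathcal{M}}\rangle$ with $\mathcal{S}^{\mathcal{M}}\subseteq M$. Elements of $\mathcal{S}^{\mathcal{M}}$ are called sets, all elements are called classes; below lowercase variables range over sets and uppercase over classes. $\mathrm{BAC}$ has axioms: (Mem) if $X\in Y$ then $X$ is a set; (Subset) if $x$ is a set and every set in $X$ is in $x$, then $X$ is a set; (Emp) there is a set $x$ with no set $y\in x$; (Adj) for all sets $x,y$ there is a set $z$ such that for all sets $u$, $u\in z\iff(u\in x\lor u=y)$; (CExt) classes $X,Y$ are equal iff they have the same set members; (Union) for sets $x,y$ there is a set $z$ whose set members are those in $x$ or $y$; (UB) for every set $x$ there is a set $y\notin x$; (CUnion), (CIntersection) for classes $X,Y$ there is a class whose set members are exactly those in $X$ or $Y$ (resp. in both); (CComp) for every class $X$ there is a class $Y$ whose set members are exactly the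 sets not in $X$. $X\subseteq^{\mathcal{M}}Y$ iff every set $x$ with $x\in^{\mathcal{M}}X$ satisfies $x\in^{\mathcal{M}}Y$. $\mathrm{IABA}$ is the theory of infinite atomic Boolean algebras (in the language $\{\sqsubseteq\}$): $\sqsubseteq$ is a distributive, complemented lattice order with least element $0$ and greatest element $1$, every nonzero element has an atom (nonzero $a$ whose only lower elements are $0$ and $a$) below it, and there are infinitely many atoms. A proper ideal $I$ of a model of $\mathrm{IABA}$ is a set with $0\in I$, $1\notin I$, closed under binary joins and downward closed. -}

module Defs where

open import Data.Nat using (ℕ)
open import Data.Fin using (Fin)
open import Data.Product using (Σ; Σ-syntax; _×_; proj₁)
open import Data.Sum using (_⊎_)
open import Relation.Nullary using (¬_)
open import Relation.Binary.PropositionalEquality using (_≡_)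
open import Relation.Binary.Structures using (IsPartialOrder)
open import Function using (_⇔_)
open import Function.Definitions using (Injective)

-- L_cl-structures: carrier M, predicate S (the sets), relation ∈.
-- Equality of the first-order structure is propositional equality on M.

record ClStructure : Set₁ where
  field
    M   : Set
    S   : M → Set
    _∈_ : M → M → Set

module _ (𝓜 : ClStructure) where
  open ClStructure 𝓜

  -- the axioms of BAC; "for all sets x" is ∀ x → S x → …
  record IsBAC : Set where
    field
      Mem    : ∀ X Y → X ∈ Y → S X
      Subset : ∀ x X → S x → (∀ y → S y → y ∈ X → y ∈ x) → S X
      Emp    : Σ[ x ∈ M ] (S x × (∀ y → S y → ¬ (y ∈ x)))
      Adj    : ∀ x y → S x → S y →
               Σ[ z ∈ M ] (S z × (∀ u → S u → (u ∈ z ⇔ (u ∈ x ⊎ u ≡ y))))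
      CExt   : ∀ X Y → (X ≡ Y ⇔ (∀ u → S u → (u ∈ X ⇔ u ∈ Y)))
      Union  : ∀ x y → S x → S y →
               Σ[ z ∈ M ] (S z × (∀ u → S u → (u ∈ z ⇔ (u ∈ x ⊎ u ∈ y))))
      UB     : ∀ x → S x → Σ[ y ∈ M ] (S y × ¬ (y ∈ x))
      CUnion : ∀ X Y → Σ[ Z ∈ M ] (∀ u → S u → (u ∈ Z ⇔ (u ∈ X ⊎ u ∈ Y)))
      CIntersection : ∀ X Y → Σ[ Z ∈ M ] (∀ u → S u → (u ∈ Z ⇔ (u ∈ X × u ∈ Y)))
      CComp  : ∀ X → Σ[ Y ∈ M ] (∀ u → S u → (u ∈ Y ⇔ (¬ (u ∈ X))))

  _⊆_ : M → M → Set
  X ⊆ Y = ∀ x → S x → x ∈ X → x ∈ Y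

module _ {A : Set} (_⊑_ : A → A → Set) where

  IsJoin : A → A → A → Set
  IsJoin a b j = a ⊑ j × b ⊑ j × (∀ c → a ⊑ c → b ⊑ c → j ⊑ c)

  IsMeet : A → A → A → Set
  IsMeet a b m = m ⊑ a × m ⊑ b × (∀ c → c ⊑ a → c ⊑ b → c ⊑ m)

  record IsIABA : Set where
    field
      isPartialOrder : IsPartialOrder _≡_ _⊑_
      join     : ∀ a b → Σ[ j ∈ A ] IsJoin a b j
      meet     : ∀ a b → Σ[ m ∈ A ] IsMeet a b m
      -- a ⊓ (b ⊔ c) = (a ⊓ b) ⊔ (a ⊓ c)
      distrib  : ∀ a b c d e f g → IsJoin b c d → IsMeet a d e →
                 IsMeet a b f → IsMeet a c g → IsJoin f g e
      𝟘        : A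
      𝟙        : A
      𝟘-least  : ∀ a → 𝟘 ⊑ a
      𝟙-great  : ∀ a → a ⊑ 𝟙
      compl    : ∀ a → Σ[ b ∈ A ] (IsMeet a b 𝟘 × IsJoin a b 𝟙)

    IsAtom : A → Set
    IsAtom a = ¬ (a ≡ 𝟘) × (∀ b → b ⊑ a → b ≡ 𝟘 ⊎ b ≡ a)

    field
      atomic   : ∀ a → ¬ (a ≡ 𝟘) → Σ[ t ∈ A ] (IsAtom t × t ⊑ a)
      -- infinitely many atoms: for every n there are n distinct atoms
      infAtoms : ∀ (n : ℕ) → Σ[ f ∈ (Fin n → A) ] (Injective _≡_ _≡_ f × (∀ i → IsAtom (f i)))

  record IsProperIdeal (B : IsIABA) (I : A → Set) : Set where
    open IsIABA B
    field
      𝟘∈I      : I 𝟘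
      𝟙∉I      : ¬ I 𝟙
      join-cl  : ∀ a b j → I a → I b → IsJoin a b j → I j
      down-cl  : ∀ a b → b ⊑ a → I a → I b

-- Equal cardinality of two subsets P, Q of a type A (subsets are
-- identified by their elements, i.e. proofs of membership are ignored):
-- a bijection between {x | P x} and {x | Q x}.

record SameCard {A : Set} (P Q : A → Set) : Set where
  field
    to          : Σ A P → Σ A Q
    to-wd       : ∀ s t → proj₁ s ≡ proj₁ t → proj₁ (to s) ≡ proj₁ (to t)
    to-inj      : ∀ s t → proj₁ (to s) ≡ proj₁ (to t) → proj₁ s ≡ proj₁ t
    to-surj     : ∀ (q : Σ A Q) → Σ[ s ∈ Σ A P ] (proj₁ (to s) ≡ proj₁ q)

-- By class extensionality, a class is determined by its set members, and
-- the class operations of BAC compute unions, intersections and complements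
-- memberwise; so ⊆ makes the classes a power-set algebra on the sets.  Its
-- atoms are exactly the singletons {y} = Adj(∅, y), which are sets, and
-- y ↦ {y} is a bijection from sets onto atoms.  UB together with Adj builds
-- sets with arbitrarily many distinct members, hence infinitely many atoms.
-- The sets form a proper ideal: Subset closes them downwards, Union under
-- joins, and UB shows the universal class is not a set.
module Submission where

open import Defs
open import Level using (0ℓ)
open import Axiom.ExcludedMiddle using (ExcludedMiddle)
open import Data.Empty using (⊥-elim)
open import Data.Fin using (zero; suc)
open import Data.Nat using (zero; suc)
open import Data.Product using (Σ-syntax; _×_; _,_; proj₁; proj₂)
open import Data.Sum using (_⊎_; inj₁; inj₂; [_,_])
import Data.Sum as Sum
open import Data.Vec.Functional using (Vector; []; _∷_)
open import Function.Bundles using (_⇔_; mk⇔; Equivalence)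
open import Function.Definitions using (Injective)
open import Relation.Nullary using (¬_; yes; no; contradiction)
open import Relation.Binary.PropositionalEquality
  using (_≡_; refl; sym; cong; subst; isEquivalence)
open import Relation.Binary.Structures using (IsPartialOrder)

module ClassAlgebra (𝓜 : ClStructure) (bac : IsBAC 𝓜) where
  open ClStructure 𝓜
  open IsBAC bac
  open Equivalence using (to; from)

  infix 4 _⊑_
  _⊑_ : M → M → Set
  _⊑_ = _⊆_ 𝓜

  IsUnion : M → M → M → Set
  IsUnion X Y Z = ∀ u → S u → (u ∈ Z ⇔ (u ∈ X ⊎ u ∈ Y))

  IsIntersection : M → M → M → Set
  IsIntersection X Y Z = ∀ u → S u → (u ∈ Z ⇔ (u ∈ X × u ∈ Y))

  ⊑-antisym : ∀ {X Y} → X ⊑ Y → Y ⊑ X → X ≡ Y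
  ⊑-antisym {X} {Y} X⊑Y Y⊑X = from (CExt X Y) (λ u su → mk⇔ (X⊑Y u su) (Y⊑X u su))

  ⊑-isPartialOrder : IsPartialOrder _≡_ _⊑_
  ⊑-isPartialOrder = record
    { isPreorder = record
      { isEquivalence = isEquivalence
      ; reflexive = λ { refl u su u∈X → u∈X }
      ; trans = λ X⊑Y Y⊑Z u su u∈X → Y⊑Z u su (X⊑Y u su u∈X)
      }
    ; antisym = ⊑-antisym
    }

  isUnion⇒isJoin : ∀ {X Y Z} → IsUnion X Y Z → IsJoin _⊑_ X Y Z
  isUnion⇒isJoin Z≐ =
    (λ u su u∈X → from (Z≐ u su) (inj₁ u∈X)) ,
    (λ u su u∈Y → from (Z≐ u su) (inj₂ u∈Y)) ,
    λ C X⊑C Y⊑C u su u∈Z → [ X⊑C u su , Y⊑C u su ] (to (Z≐ u su) u∈Z)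

  isJoin⇒isUnion : ∀ {X Y J} → IsJoin _⊑_ X Y J → IsUnion X Y J
  isJoin⇒isUnion {X} {Y} (X⊑J , Y⊑J , J-least) u su =
    mk⇔ (λ u∈J → to (Z≐ u su) (J-least Z X⊑Z Y⊑Z u su u∈J)) [ X⊑J u su , Y⊑J u su ]
    where
      Z : M
      Z = proj₁ (CUnion X Y)
      Z≐ : IsUnion X Y Z
      Z≐ = proj₂ (CUnion X Y)
      X⊑Z : X ⊑ Z
      X⊑Z = proj₁ (isUnion⇒isJoin Z≐)
      Y⊑Z : Y ⊑ Z
      Y⊑Z = proj₁ (proj₂ (isUnion⇒isJoin Z≐))

  isIntersection⇒isMeet : ∀ {X Y Z} → IsIntersection X Y Z → IsMeet _⊑_ X Y Z
  isIntersection⇒isMeet Z≐ =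
    (λ u su u∈Z → proj₁ (to (Z≐ u su) u∈Z)) ,
    (λ u su u∈Z → proj₂ (to (Z≐ u su) u∈Z)) ,
    λ C C⊑X C⊑Y u su u∈C → from (Z≐ u su) (C⊑X u su u∈C , C⊑Y u su u∈C)

  isMeet⇒isIntersection : ∀ {X Y I} → IsMeet _⊑_ X Y I → IsIntersection X Y I
  isMeet⇒isIntersection {X} {Y} (I⊑X , I⊑Y , I-greatest) u su =
    mk⇔ (λ u∈I → I⊑X u su u∈I , I⊑Y u su u∈I)
        (λ (u∈X , u∈Y) → I-greatest Z Z⊑X Z⊑Y u su (from (Z≐ u su) (u∈X , u∈Y)))
    where
      Z : M
      Z = proj₁ (CIntersection X Y)
      Z≐ : IsIntersection X Y Z
      Z≐ = proj₂ (CIntersection X Y)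
      Z⊑X : Z ⊑ X
      Z⊑X = proj₁ (isIntersection⇒isMeet Z≐)
      Z⊑Y : Z ⊑ Y
      Z⊑Y = proj₁ (proj₂ (isIntersection⇒isMeet Z≐))

  ⊑-distrib : ∀ a b c d e f g → IsJoin _⊑_ b c d → IsMeet _⊑_ a d e →
              IsMeet _⊑_ a b f → IsMeet _⊑_ a c g → IsJoin _⊑_ f g e
  ⊑-distrib _ _ _ _ _ _ _ d-join e-meet f-meet g-meet = isUnion⇒isJoin λ u su →
    let d≐ = isJoin⇒isUnion d-join u su
        e≐ = isMeet⇒isIntersection e-meet u su
        f≐ = isMeet⇒isIntersection f-meet u su
        g≐ = isMeet⇒isIntersection g-meet u su
    in mk⇔
      (λ u∈e → let (u∈a , u∈d) = to e≐ u∈e in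
        Sum.map (λ u∈b → from f≐ (u∈a , u∈b)) (λ u∈c → from g≐ (u∈a , u∈c)) (to d≐ u∈d))
      [ (λ u∈f → let (u∈a , u∈b) = to f≐ u∈f in from e≐ (u∈a , from d≐ (inj₁ u∈b)))
      , (λ u∈g → let (u∈a , u∈c) = to g≐ u∈g in from e≐ (u∈a , from d≐ (inj₂ u∈c)))
      ]

  ∅ : M
  ∅ = proj₁ Emp

  ∅-isSet : S ∅
  ∅-isSet = proj₁ (proj₂ Emp)

  ∉∅ : ∀ u → S u → ¬ u ∈ ∅
  ∉∅ = proj₂ (proj₂ Emp)

  ∅-least : ∀ X → ∅ ⊑ X
  ∅-least X u su u∈∅ = ⊥-elim (∉∅ u su u∈∅)

  𝕍 : M
  𝕍 = proj₁ (CComp ∅)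

  ∈𝕍 : ∀ u → S u → u ∈ 𝕍
  ∈𝕍 u su = from (proj₂ (CComp ∅) u su) (∉∅ u su)

  𝕍-greatest : ∀ X → X ⊑ 𝕍
  𝕍-greatest X u su _ = ∈𝕍 u su

  ⊑-complement : ExcludedMiddle 0ℓ →
                 ∀ X → Σ[ Y ∈ M ] (IsMeet _⊑_ X Y ∅ × IsJoin _⊑_ X Y 𝕍)
  ⊑-complement em X = ∁X ,
    isIntersection⇒isMeet (λ u su →
      mk⇔ (λ u∈∅ → ⊥-elim (∉∅ u su u∈∅))
          (λ (u∈X , u∈∁X) → contradiction u∈X (to (∁X≐ u su) u∈∁X))) ,
    isUnion⇒isJoin (λ u su →
      mk⇔ (λ _ → case-em u su) (λ _ → ∈𝕍 u su))
    where
      ∁X : M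
      ∁X = proj₁ (CComp X)
      ∁X≐ : ∀ u → S u → (u ∈ ∁X ⇔ (¬ u ∈ X))
      ∁X≐ = proj₂ (CComp X)
      case-em : ∀ u → S u → u ∈ X ⊎ u ∈ ∁X
      case-em u su with em {u ∈ X}
      ... | yes u∈X = inj₁ u∈X
      ... | no u∉X = inj₂ (from (∁X≐ u su) u∉X)

  ≢∅⇒hasMember : ExcludedMiddle 0ℓ → ∀ X → ¬ X ≡ ∅ → Σ[ u ∈ M ] (S u × u ∈ X)
  ≢∅⇒hasMember em X X≢∅ with em {Σ[ u ∈ M ] (S u × u ∈ X)}
  ... | yes member = member
  ... | no noMember =
    contradiction (⊑-antisym (λ u su u∈X → ⊥-elim (noMember (u , su , u∈X))) (∅-least X)) X≢∅

  singleton : ∀ y → S y → M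
  singleton y sy = proj₁ (Adj ∅ y ∅-isSet sy)

  singleton-isSet : ∀ y sy → S (singleton y sy)
  singleton-isSet y sy = proj₁ (proj₂ (Adj ∅ y ∅-isSet sy))

  ∈-singleton : ∀ y sy u → S u → (u ∈ singleton y sy ⇔ u ≡ y)
  ∈-singleton y sy u su = mk⇔
    (λ u∈sy → [ (λ u∈∅ → ⊥-elim (∉∅ u su u∈∅)) , (λ u≡y → u≡y) ] (to (adj u su) u∈sy))
    (λ u≡y → from (adj u su) (inj₂ u≡y))
    where adj = proj₂ (proj₂ (Adj ∅ y ∅-isSet sy))

  y∈singleton : ∀ y sy → y ∈ singleton y sy
  y∈singleton y sy = from (∈-singleton y sy y sy) refl

  singleton-⊑ : ∀ {X} y sy → y ∈ X → singleton y sy ⊑ X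
  singleton-⊑ {X} y sy y∈X u su u∈sy =
    subst (_∈ X) (sym (to (∈-singleton y sy u su) u∈sy)) y∈X

  singleton-irrelevant : ∀ y (sy sy′ : S y) → singleton y sy ≡ singleton y sy′
  singleton-irrelevant y sy sy′ =
    ⊑-antisym (singleton-⊑ y sy (y∈singleton y sy′)) (singleton-⊑ y sy′ (y∈singleton y sy))

  singleton-injective : ∀ y sy z sz → singleton y sy ≡ singleton z sz → y ≡ z
  singleton-injective y sy z sz eq =
    to (∈-singleton z sz y sy) (subst (y ∈_) eq (y∈singleton y sy))

  IsAtom : M → Set
  IsAtom a = ¬ (a ≡ ∅) × (∀ b → b ⊑ a → b ≡ ∅ ⊎ b ≡ a)

  singleton-isAtom : ExcludedMiddle 0ℓ → ∀ y sy → IsAtom (singleton y sy)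
  singleton-isAtom em y sy = nonempty , lowerBound
    where
      nonempty : ¬ singleton y sy ≡ ∅
      nonempty eq = ∉∅ y sy (subst (y ∈_) eq (y∈singleton y sy))
      lowerBound : ∀ b → b ⊑ singleton y sy → b ≡ ∅ ⊎ b ≡ singleton y sy
      lowerBound b b⊑sy with em {y ∈ b}
      ... | yes y∈b = inj₂ (⊑-antisym b⊑sy (singleton-⊑ y sy y∈b))
      ... | no y∉b = inj₁ (⊑-antisym b⊑∅ (∅-least b))
        where
          b⊑∅ : b ⊑ ∅
          b⊑∅ u su u∈b =
            contradiction (subst (_∈ b) (to (∈-singleton y sy u su) (b⊑sy u su u∈b)) u∈b) y∉b

  atom⇒singleton : ExcludedMiddle 0ℓ → ∀ a → IsAtom a → Σ[ y ∈ M ] Σ[ sy ∈ S y ] a ≡ singleton y sy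
  atom⇒singleton em a (a≢∅ , a-atom) with ≢∅⇒hasMember em a a≢∅
  ... | y , sy , y∈a with a-atom (singleton y sy) (singleton-⊑ y sy y∈a)
  ...   | inj₁ sy≡∅ = contradiction sy≡∅ (proj₁ (singleton-isAtom em y sy))
  ...   | inj₂ sy≡a = y , sy , sym sy≡a

  atom⇒set : ExcludedMiddle 0ℓ → ∀ a → IsAtom a → S a
  atom⇒set em a a-atom with atom⇒singleton em a a-atom
  ... | y , sy , refl = singleton-isSet y sy

  ⊑-atomic : ExcludedMiddle 0ℓ → ∀ X → ¬ X ≡ ∅ → Σ[ t ∈ M ] (IsAtom t × t ⊑ X)
  ⊑-atomic em X X≢∅ with ≢∅⇒hasMember em X X≢∅
  ... | y , sy , y∈X = singleton y sy , singleton-isAtom em y sy , singleton-⊑ y sy y∈X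

  setWithDistinctMembers : ∀ n → Σ[ x ∈ M ] (S x ×
    Σ[ f ∈ Vector M n ] (Injective _≡_ _≡_ f × (∀ i → f i ∈ x)))
  setWithDistinctMembers zero = ∅ , ∅-isSet , [] , (λ { {()} }) , λ ()
  setWithDistinctMembers (suc n) with setWithDistinctMembers n
  ... | x , sx , f , f-injective , f∈x with UB x sx
  ...   | y , sy , y∉x = z , sz , y ∷ f , y∷f-injective , y∷f∈z
    where
      z : M
      z = proj₁ (Adj x y sx sy)
      sz : S z
      sz = proj₁ (proj₂ (Adj x y sx sy))
      z≐ : ∀ u → S u → (u ∈ z ⇔ (u ∈ x ⊎ u ≡ y))
      z≐ = proj₂ (proj₂ (Adj x y sx sy))
      y∷f-injective : Injective _≡_ _≡_ (y ∷ f)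
      y∷f-injective {zero} {zero} _ = refl
      y∷f-injective {zero} {suc j} y≡fj = contradiction (subst (_∈ x) (sym y≡fj) (f∈x j)) y∉x
      y∷f-injective {suc i} {zero} fi≡y = contradiction (subst (_∈ x) fi≡y (f∈x i)) y∉x
      y∷f-injective {suc i} {suc j} fi≡fj = cong suc (f-injective fi≡fj)
      y∷f∈z : ∀ i → (y ∷ f) i ∈ z
      y∷f∈z zero = from (z≐ y sy) (inj₂ refl)
      y∷f∈z (suc i) = from (z≐ (f i) (Mem _ _ (f∈x i))) (inj₁ (f∈x i))

  infinitelyManyAtoms : ExcludedMiddle 0ℓ →
    ∀ n → Σ[ f ∈ Vector M n ] (Injective _≡_ _≡_ f × (∀ i → IsAtom (f i)))
  infinitelyManyAtoms em n with setWithDistinctMembers n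
  ... | x , _ , f , f-injective , f∈x =
    (λ i → singleton (f i) (s i)) ,
    (λ {i} {j} eq → f-injective (singleton-injective (f i) (s i) (f j) (s j) eq)) ,
    (λ i → singleton-isAtom em (f i) (s i))
    where
      s : ∀ i → S (f i)
      s i = Mem _ _ (f∈x i)

  ⊑-isIABA : ExcludedMiddle 0ℓ → IsIABA _⊑_
  ⊑-isIABA em = record
    { isPartialOrder = ⊑-isPartialOrder
    ; join = λ X Y → proj₁ (CUnion X Y) , isUnion⇒isJoin (proj₂ (CUnion X Y))
    ; meet = λ X Y → proj₁ (CIntersection X Y) , isIntersection⇒isMeet (proj₂ (CIntersection X Y))
    ; distrib = ⊑-distrib
    ; 𝟘 = ∅
    ; 𝟙 = 𝕍
    ; 𝟘-least = ∅-least
    ; 𝟙-great = 𝕍-greatest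
    ; compl = ⊑-complement em
    ; atomic = ⊑-atomic em
    ; infAtoms = infinitelyManyAtoms em
    }

  𝕍-notSet : ¬ S 𝕍
  𝕍-notSet s𝕍 with UB 𝕍 s𝕍
  ... | y , sy , y∉𝕍 = y∉𝕍 (∈𝕍 y sy)

  join-isSet : ∀ x y j → S x → S y → IsJoin _⊑_ x y j → S j
  join-isSet x y j sx sy (_ , _ , j-least) with Union x y sx sy
  ... | z , sz , z≐ = Subset z j sz (j-least z x⊑z y⊑z)
    where
      x⊑z : x ⊑ z
      x⊑z = proj₁ (isUnion⇒isJoin z≐)
      y⊑z : y ⊑ z
      y⊑z = proj₁ (proj₂ (isUnion⇒isJoin z≐))

  sets-isProperIdeal : (em : ExcludedMiddle 0ℓ) → IsProperIdeal _⊑_ (⊑-isIABA em) S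
  sets-isProperIdeal em = record
    { 𝟘∈I = ∅-isSet
    ; 𝟙∉I = 𝕍-notSet
    ; join-cl = join-isSet
    ; down-cl = λ X Y Y⊑X sX → Subset X Y sX Y⊑X
    }

  sets≈atoms : ExcludedMiddle 0ℓ → SameCard S IsAtom
  sets≈atoms em = record
    { to = λ (y , sy) → singleton y sy , singleton-isAtom em y sy
    ; to-wd = λ { (y , sy) (.y , sy′) refl → singleton-irrelevant y sy sy′ }
    ; to-inj = λ (y , sy) (z , sz) → singleton-injective y sy z sz
    ; to-surj = λ (a , a-atom) →
        let (y , sy , a≡sy) = atom⇒singleton em a a-atom in (y , sy) , sym a≡sy
    }

mainTheorem9 : ExcludedMiddle 0ℓ → (𝓜 : ClStructure) → IsBAC 𝓜 →
    Σ[ B ∈ IsIABA (_⊆_ 𝓜) ]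
      (IsProperIdeal (_⊆_ 𝓜) B (ClStructure.S 𝓜)
       × (∀ a → IsIABA.IsAtom B a → ClStructure.S 𝓜 a)
       × SameCard (ClStructure.S 𝓜) (IsIABA.IsAtom B))
mainTheorem9 em 𝓜 bac = ⊑-isIABA em , sets-isProperIdeal em , atom⇒set em , sets≈atoms em
  where open ClassAlgebra 𝓜 bac
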